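{- If a graph $G$ has a directed lacon-decomposition $(L,\pi)$, then $G$ also has an (undirected) lacon-decomposition $(L',\pi')$ with $\mathrm{col}_r(L',\pi')\le 4^{\mathrm{col}_2(L,\pi)}\cdot\mathrm{col}_r(L,\pi)$ and $\mathrm{wcol}_r(L',\pi')\le 4^{\mathrm{col}_2(L,\pi)}\cdot\mathrm{wcol}_r(L,\pi)$ for all $r$.
   Context: A linear order on vertices is an injective map $\pi:V\to\mathbb N$. For a graph and order $\pi$: $u$ is $r$-reachable from $v$ if $\pi(u)\le\pi(v)$ and there is a path of length at most $r$ from $v$ to $u$ all of whose vertices $w$ satisfy $w=u$ or $\pi(w)\ge\pi(v)$; $u$ is weakly $r$-reachable from $v$ if there is a path of length at most $r$ from $v$ to $u$ with $\pi(u)\le\pi(w)$ for all $w$ on the path. For directed graphs, reachability is taken in the underlying undirected graph. $\mathrm{col}_r(G,\pi)$ (resp. $\mathrm{wcol}_r(G,\pi)$) is the maximum over $v$ of the number of vertices $r$-reachable (resp. weakly $r$-reachable) from $v$. Lacon-decomposition: a pair $(L,\pi)$ where $L$ is a bipartite graph with sides $T$ (target vertices) and $H$ (hidden vertices), each hidden vertex is labeled "0" or "1", $\pi$ is a linear order on $V(L)$ with $\pi(h)<\pi(t)$ for all $h\in H,t\in T$, and for all $t,t'\in T$ we have $N(t)\cap N(t')\neq\emptyset$; the $\pi$-largest vertex of $N(t)\cap N(t')$ is the dominant vertex of $t,t'$. It is a lacon-decomposition of a graph $G$ if $V(G)=T$ and for all $t\ne t'\in T$, $tt'\in E(G)$ iff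 the dominant vertex of $t,t'$ is labeled "1". Directed lacon-decomposition: the same, except $L$ is a directed bipartite graph and the condition uses $D(t,t')=(N^-(t)\cap N^+(t'))\cup(N^+(t)\cap N^-(t'))$ ($N^-,N^+$ in-/out-neighborhoods) in place of $N(t)\cap N(t')$: $D(t,t')\neq\emptyset$ for all $t,t'\in T$, the dominant vertex is the $\pi$-largest element of $D(t,t')$, and it is a directed lacon-decomposition of $G$ if $V(G)=T$ and $tt'\in E(G)$ iff the dominant vertex of $t\neq t'$ is labeled "1". -}

module Defs where

open import Data.Nat using (ℕ; zero; suc; _≤_; _<_; _^_; _*_)
open import Data.Fin using (Fin)
open import Data.Bool using (Bool; true; false; _∨_)
open import Data.Sum using (_⊎_; inj₁; inj₂)
open import Data.Product using (Σ; ∃; ∃-syntax; _×_; _,_)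
open import Data.Empty using (⊥)
open import Data.List using (List; []; _∷_; length)
open import Data.List.Relation.Unary.All using (All)
open import Data.List.Relation.Unary.Unique.Propositional using (Unique)
open import Relation.Binary.PropositionalEquality using (_≡_; _≢_)
open import Relation.Nullary using (¬_)
open import Function.Definitions using (Injective)
open import Function.Bundles using (_⇔_)

record SimpleGraph (n : ℕ) : Set₁ where
  field
    Adj     : Fin n → Fin n → Set
    sym     : ∀ {u v} → Adj u v → Adj v u
    irrefl  : ∀ {v} → ¬ Adj v v

IsLinearOrder : {V : Set} → (V → ℕ) → Set
IsLinearOrder π = Injective _≡_ _≡_ π

data Walk {V : Set} (Adj : V → V → Set) : V → V → ℕ → List V → Set where
  here : ∀ v → Walk Adj v v 0 (v ∷ [])
  step : ∀ {v w u k ws} → Adj v w → Walk Adj w u k ws → Walk Adj v u (suc k) (v ∷ ws)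

Path : {V : Set} (Adj : V → V → Set) → V → V → ℕ → List V → Set
Path Adj v u k ws = Walk Adj v u k ws × Unique ws

Reach : {V : Set} (Adj : V → V → Set) (π : V → ℕ) (r : ℕ) → V → V → Set
Reach Adj π r v u =
  π u ≤ π v ×
  ∃[ k ] ∃[ ws ] (k ≤ r × Path Adj v u k ws × All (λ w → w ≡ u ⊎ π v ≤ π w) ws)

WReach : {V : Set} (Adj : V → V → Set) (π : V → ℕ) (r : ℕ) → V → V → Set
WReach Adj π r v u =
  ∃[ k ] ∃[ ws ] (k ≤ r × Path Adj v u k ws × All (λ w → π u ≤ π w) ws)

MaxCountLe : {V : Set} → (V → V → Set) → ℕ → Set
MaxCountLe {V} R c = ∀ (v : V) (us : List V) → Unique us → All (R v) us → length us ≤ c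

ColLe : {V : Set} (Adj : V → V → Set) (π : V → ℕ) (r c : ℕ) → Set
ColLe Adj π r c = MaxCountLe (Reach Adj π r) c

WColLe : {V : Set} (Adj : V → V → Set) (π : V → ℕ) (r c : ℕ) → Set
WColLe Adj π r c = MaxCountLe (WReach Adj π r) c

-- Bipartite graphs with target side T = Fin n and hidden side H = Fin m.
-- Vertex set of L is Fin n ⊎ Fin m (inj₁ = target, inj₂ = hidden).

record BipGraph (n m : ℕ) : Set where
  field
    E     : Fin n → Fin m → Bool
    label : Fin m → Bool          -- true = "1", false = "0"

BipAdj : {n m : ℕ} → BipGraph n m → Fin n ⊎ Fin m → Fin n ⊎ Fin m → Set
BipAdj L (inj₁ t) (inj₂ h) = BipGraph.E L t h ≡ true
BipAdj L (inj₂ h) (inj₁ t) = BipGraph.E L t h ≡ true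
BipAdj L (inj₁ _) (inj₁ _) = ⊥
BipAdj L (inj₂ _) (inj₂ _) = ⊥

-- Directed bipartite graph: out t h = true iff arc t → h; inn t h = true iff arc h → t
record DBipGraph (n m : ℕ) : Set where
  field
    out   : Fin n → Fin m → Bool
    inn   : Fin n → Fin m → Bool
    label : Fin m → Bool

DBipAdj : {n m : ℕ} → DBipGraph n m → Fin n ⊎ Fin m → Fin n ⊎ Fin m → Set
DBipAdj L (inj₁ t) (inj₂ h) = (DBipGraph.out L t h ∨ DBipGraph.inn L t h) ≡ true
DBipAdj L (inj₂ h) (inj₁ t) = (DBipGraph.out L t h ∨ DBipGraph.inn L t h) ≡ true
DBipAdj L (inj₁ _) (inj₁ _) = ⊥
DBipAdj L (inj₂ _) (inj₂ _) = ⊥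

IsDominant : {n m : ℕ} (π : Fin n ⊎ Fin m → ℕ) (P : Fin m → Set) → Fin m → Set
IsDominant π P h = P h × (∀ h' → P h' → π (inj₂ h') ≤ π (inj₂ h))

CommonNb : {n m : ℕ} → BipGraph n m → Fin n → Fin n → Fin m → Set
CommonNb L t t' h = BipGraph.E L t h ≡ true × BipGraph.E L t' h ≡ true

DSet : {n m : ℕ} → DBipGraph n m → Fin n → Fin n → Fin m → Set
DSet L t t' h =
  (DBipGraph.inn L t h ≡ true × DBipGraph.out L t' h ≡ true) ⊎
  (DBipGraph.out L t h ≡ true × DBipGraph.inn L t' h ≡ true)

IsLaconDecomp : {n m : ℕ} → SimpleGraph n → BipGraph n m → (Fin n ⊎ Fin m → ℕ) → Set
IsLaconDecomp {n} {m} G L π =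
  IsLinearOrder π ×
  (∀ (h : Fin m) (t : Fin n) → π (inj₂ h) < π (inj₁ t)) ×
  (∀ (t t' : Fin n) → ∃[ h ] CommonNb L t t' h) ×
  (∀ (t t' : Fin n) → t ≢ t' → ∀ h → IsDominant π (CommonNb L t t') h →
     (SimpleGraph.Adj G t t' ⇔ BipGraph.label L h ≡ true))

IsDirLaconDecomp : {n m : ℕ} → SimpleGraph n → DBipGraph n m → (Fin n ⊎ Fin m → ℕ) → Set
IsDirLaconDecomp {n} {m} G L π =
  IsLinearOrder π ×
  (∀ (h : Fin m) (t : Fin n) → π (inj₂ h) < π (inj₁ t)) ×
  (∀ (t t' : Fin n) → ∃[ h ] DSet L t t' h) ×
  (∀ (t t' : Fin n) → t ≢ t' → ∀ h → IsDominant π (DSet L t t') h →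
     (SimpleGraph.Adj G t t' ⇔ DBipGraph.label L h ≡ true))

{-# OPTIONS --safe #-}
-- Every hidden vertex h of L is split into copies (h, w), where the word w prescribes, at
-- each later hidden vertex q, whether a target joined to the copy must have only an in-arc,
-- only an out-arc, or anything at q. For targets t ≠ t' with dominant vertex d, the copy of
-- d recording the patterns that t and t' share above d is a common neighbour, and every
-- other common neighbour comes before it in the lexicographic order of weights read from
-- the latest hidden vertex down; so it is dominant and carries the label of d. Sending each
-- copy to the latest hidden vertex it constrains is a monotone homomorphism onto L, so it
-- preserves (weak) r-reachability, and a non-isolated copy in the fibre over h is determined
-- by four-valued data on the at most col₂ hidden vertices 2-reachable from h; this gives
-- the factor 4 ^ col₂.
module Submission where

open import Defs
open import Data.Bool using (true; false; _∨_)
open import Data.Bool.Properties using (∨-zeroʳ) renaming (_≟_ to _≟ᵇ_)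
open import Data.Empty using (⊥-elim)
open import Data.Fin using (Fin; zero; suc; toℕ; fromℕ; inject₁; combine; remainder; quotient; finToFun; funToFin)
open import Data.Fin.Properties
  using (pigeonhole; any?; all?; toℕ<n; toℕ-injective; inject₁-injective; fromℕ≢inject₁;
         remQuot-combine; combine-remQuot; finToFun-funToFin; funToFin-finToFin)
  renaming (_≟_ to _≟ᶠ_; <⇒≢ to <⇒≢ᶠ)
open import Data.List using (List; []; _∷_; length; filter; map; allFin) renaming (lookup to lookupˡ)
open import Data.List.Properties using (length-map)
open import Data.List.Membership.Propositional using (_∈_)
open import Data.List.Membership.Propositional.Properties using (∈-lookup; ∈-filter⁺; ∈-filter⁻; ∈-allFin)
import Data.List.Membership.DecPropositional as DecMembership
open import Data.List.Relation.Binary.Subset.Propositional using (_⊆_)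
open import Data.List.Relation.Unary.All as All using (All; []; _∷_)
import Data.List.Relation.Unary.All.Properties as All
open import Data.List.Relation.Unary.AllPairs using ([]; _∷_)
open import Data.List.Relation.Unary.Any using (here; there; index)
open import Data.List.Relation.Unary.Any.Properties using (lookup-index)
open import Data.List.Relation.Unary.Unique.Propositional using (Unique)
import Data.List.Relation.Unary.Unique.Propositional.Properties as Unique
open import Data.Nat using (ℕ; zero; suc; _+_; _*_; _^_; _≤_; _<_; _⊔_; z≤n; s≤s; NonZero; >-nonZero⁻¹)
open import Data.Nat.Properties
open import Data.Product using (Σ; ∃; ∃-syntax; _×_; _,_; proj₁; proj₂)
open import Data.Sum using (_⊎_; inj₁; inj₂)
open import Data.Sum.Properties using (inj₁-injective; inj₂-injective; ≡-dec)
open import Data.Unit using (⊤; tt)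
open import Function using (_∘_; id)
open import Function.Bundles using (_⇔_)
open import Relation.Binary using (DecidableEquality; tri<; tri≈; tri>)
open import Relation.Binary.PropositionalEquality
open import Relation.Nullary using (¬_; Dec; yes; no; does)
open import Relation.Nullary.Decidable using (_×-dec_; _⊎-dec_; _→-dec_; dec-true)
open import Relation.Unary using (Decidable)
open import Relation.Unary.Properties using (∁?)

m*b+x<n*b+y : ∀ {m n x y b} → x < b → m < n → m * b + x < n * b + y
m*b+x<n*b+y {m} {n} {x} {y} {b} x<b m<n = begin-strict
  m * b + x <⟨ +-monoʳ-< (m * b) x<b ⟩
  m * b + b ≡⟨ +-comm (m * b) b ⟩
  suc m * b ≤⟨ *-monoˡ-≤ b m<n ⟩
  n * b     ≤⟨ m≤m+n (n * b) y ⟩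
  n * b + y ∎
  where open ≤-Reasoning

m*b+x≡n*b+y⇒x≡y : ∀ {m n x y b} → x < b → y < b → m * b + x ≡ n * b + y → x ≡ y
m*b+x≡n*b+y⇒x≡y {m} {n} {x} {y} x<b y<b eq with <-cmp m n
... | tri< m<n _ _ = ⊥-elim (<⇒≢ (m*b+x<n*b+y x<b m<n) eq)
... | tri> _ _ n<m = ⊥-elim (<⇒≢ (m*b+x<n*b+y y<b n<m) (sym eq))
... | tri≈ _ refl _ = +-cancelˡ-≡ (m * _) x y eq

fromDigits : ℕ → ℕ → (ℕ → ℕ) → ℕ
fromDigits b zero    d = 0
fromDigits b (suc k) d = d k * b ^ k + fromDigits b k d

Digits : ℕ → (ℕ → ℕ) → Set
Digits b d = ∀ j → d j < b

fromDigits<b^k : ∀ {b d} → Digits b d → ∀ k → fromDigits b k d < b ^ k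
fromDigits<b^k digits zero    = s≤s z≤n
fromDigits<b^k {b} {d} digits (suc k) = begin-strict
  d k * b ^ k + fromDigits b k d <⟨ m*b+x<n*b+y (fromDigits<b^k digits k) (n<1+n (d k)) ⟩
  suc (d k) * b ^ k + 0          ≡⟨ +-identityʳ _ ⟩
  suc (d k) * b ^ k              ≤⟨ *-monoˡ-≤ (b ^ k) (digits k) ⟩
  b * b ^ k                      ∎
  where open ≤-Reasoning

fromDigits-lex : ∀ {b d d'} → Digits b d → ∀ k {k₀} → k₀ < k → d k₀ < d' k₀ →
  (∀ j → k₀ < j → j < k → d j ≤ d' j) → fromDigits b k d < fromDigits b k d'
fromDigits-lex {b} digits (suc k) {k₀} k₀<1+k lt above with <-cmp k₀ k
... | tri≈ _ refl _ = m*b+x<n*b+y (fromDigits<b^k digits k₀) lt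
... | tri< k₀<k _ _ = +-mono-≤-< (*-monoˡ-≤ (b ^ k) (above k k₀<k (n<1+n k)))
                        (fromDigits-lex digits k k₀<k lt (λ j k₀<j j<k → above j k₀<j (m<n⇒m<1+n j<k)))
... | tri> _ _ k<k₀ = ⊥-elim (<⇒≱ k<k₀ (≤-pred k₀<1+k))

supremum : ∀ {k} → (Fin k → ℕ) → ℕ
supremum {zero}  f = 0
supremum {suc k} f = suc (f zero) ⊔ supremum (f ∘ suc)

<supremum : ∀ {k} (f : Fin k → ℕ) i → f i < supremum f
<supremum {suc k} f zero    = m≤m⊔n (suc (f zero)) (supremum (f ∘ suc))
<supremum {suc k} f (suc i) = <-≤-trans (<supremum (f ∘ suc) i) (m≤n⊔m _ _)

module Lexicographic {k : ℕ} (pos : Fin k → ℕ) (pos-injective : ∀ {p q} → pos p ≡ pos q → p ≡ q)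
                     (b : ℕ) .{{_ : NonZero b}} where

  digitAt : (Fin k → ℕ) → ℕ → ℕ
  digitAt e j with any? (λ q → pos q ≟ j)
  ... | yes (q , _) = e q
  ... | no _        = 0

  digitAt-pos : ∀ e q → digitAt e (pos q) ≡ e q
  digitAt-pos e q with any? (λ q' → pos q' ≟ pos q)
  ... | yes (q' , eq) = cong e (pos-injective eq)
  ... | no none       = ⊥-elim (none (q , refl))

  digitAt-mono : ∀ e e' j → (∀ q → pos q ≡ j → e q ≤ e' q) → digitAt e j ≤ digitAt e' j
  digitAt-mono e e' j mono with any? (λ q → pos q ≟ j)
  ... | yes (q , eq) = mono q eq
  ... | no _         = z≤n

  digitAt-digits : ∀ {e} → (∀ q → e q < b) → Digits b (digitAt e)
  digitAt-digits {e} e<b j with any? (λ q → pos q ≟ j)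
  ... | yes (q , _) = e<b q
  ... | no _        = >-nonZero⁻¹ b

  value : (Fin k → ℕ) → ℕ
  value e = fromDigits b (supremum pos) (digitAt e)

  value< : ∀ {e} → (∀ q → e q < b) → value e < b ^ supremum pos
  value< e<b = fromDigits<b^k (digitAt-digits e<b) (supremum pos)

  value-lex : ∀ {e e'} → (∀ q → e q < b) → ∀ q₀ → e q₀ < e' q₀ →
    (∀ q → pos q₀ < pos q → e q ≤ e' q) → value e < value e'
  value-lex {e} {e'} e<b q₀ lt above =
    fromDigits-lex (digitAt-digits e<b) (supremum pos) (<supremum pos q₀)
      (subst₂ _<_ (sym (digitAt-pos e q₀)) (sym (digitAt-pos e' q₀)) lt)
      (λ j q₀<j _ → digitAt-mono e e' j (λ { q refl → above q q₀<j }))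

argmax : ∀ {k} (f : Fin k → ℕ) {P : Fin k → Set} → Decidable P → ∃ P →
  ∃ λ q → P q × (∀ q' → P q' → f q' ≤ f q)
argmax {suc k} f {P} P? witness with any? (P? ∘ suc)
argmax {suc k} f P? (zero , p₀)  | no none =
  zero , p₀ , λ { zero _ → ≤-refl ; (suc i) pᵢ → ⊥-elim (none (i , pᵢ)) }
argmax {suc k} f P? (suc i , pᵢ) | no none = ⊥-elim (none (i , pᵢ))
... | yes witness' with argmax (f ∘ suc) (P? ∘ suc) witness' | P? zero
... | q , pq , max | no ¬p₀ = suc q , pq , λ { zero p₀ → ⊥-elim (¬p₀ p₀) ; (suc i) pᵢ → max i pᵢ }
... | q , pq , max | yes p₀ with f zero ≤? f (suc q)
... | yes le = suc q , pq , λ { zero _ → le ; (suc i) pᵢ → max i pᵢ }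
... | no nle = zero , p₀ , λ { zero _ → ≤-refl ; (suc i) pᵢ → ≤-trans (max i pᵢ) (<⇒≤ (≰⇒> nle)) }

Unique-lookup-injective : ∀ {A : Set} {xs : List A} → Unique xs → ∀ i j → lookupˡ xs i ≡ lookupˡ xs j → i ≡ j
Unique-lookup-injective (_ ∷ _)        zero    zero    _  = refl
Unique-lookup-injective (x∉xs ∷ _)     zero    (suc j) eq = ⊥-elim (All.lookup x∉xs (∈-lookup j) eq)
Unique-lookup-injective (x∉xs ∷ _)     (suc i) zero    eq = ⊥-elim (All.lookup x∉xs (∈-lookup i) (sym eq))
Unique-lookup-injective (_ ∷ unique)   (suc i) (suc j) eq = cong suc (Unique-lookup-injective unique i j eq)

AtMost : {A : Set} → ℕ → (A → Set) → Set
AtMost c P = ∀ xs → Unique xs → All P xs → length xs ≤ c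

length≤-injection : ∀ {A : Set} {N} (xs : List A) → Unique xs → (code : A → Fin N) →
  (∀ {a b} → a ∈ xs → b ∈ xs → code a ≡ code b → a ≡ b) → length xs ≤ N
length≤-injection {N = N} xs unique code injective with N <? length xs
... | no N≮len = ≮⇒≥ N≮len
... | yes N<len with pigeonhole N<len (code ∘ lookupˡ xs)
... | i , j , i<j , eq = ⊥-elim (<⇒≢ᶠ i<j
        (Unique-lookup-injective unique i j (injective (∈-lookup i) (∈-lookup j) eq)))

AtMost-≡ : ∀ {A : Set} (v : A) → AtMost 1 (_≡ v)
AtMost-≡ v []               _                  _                 = z≤n
AtMost-≡ v (_ ∷ [])         _                  _                 = s≤s z≤n
AtMost-≡ v (_ ∷ _ ∷ _)      ((v≢v ∷ _) ∷ _)    (refl ∷ refl ∷ _) = ⊥-elim (v≢v refl)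

length-filter+length-filter-∁ : ∀ {A : Set} {P : A → Set} (P? : Decidable P) xs →
  length (filter P? xs) + length (filter (∁? P?) xs) ≡ length xs
length-filter+length-filter-∁ P? []       = refl
length-filter+length-filter-∁ P? (x ∷ xs) with P? x
... | yes _ = cong suc (length-filter+length-filter-∁ P? xs)
... | no _  = trans (+-suc _ _) (cong suc (length-filter+length-filter-∁ P? xs))

AtMost-fibres : ∀ {A B : Set} → DecidableEquality B → (f : A → B) → ∀ {R : A → Set} {Q : B → Set} {K} c →
  (∀ b → AtMost K (λ a → R a × f a ≡ b)) → AtMost c Q → AtMost (K * c) (λ a → R a × Q (f a))
AtMost-fibres _≟ᴮ_ f c fibre image [] _ _ = z≤n
AtMost-fibres _≟ᴮ_ f zero fibre image (a ∷ _) _ ((_ , qa) ∷ _) =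
  ⊥-elim (1+n≰n (image (f a ∷ []) ([] ∷ []) (qa ∷ [])))
AtMost-fibres _≟ᴮ_ f {Q = Q} {K} (suc c) fibre image (a ∷ as) unique rqs = begin
  length (a ∷ as)                      ≡⟨ sym (length-filter+length-filter-∁ sameImage? (a ∷ as)) ⟩
  length inside + length outside       ≤⟨ +-mono-≤ inFibre outsideFibre ⟩
  K + K * c                            ≡⟨ sym (*-suc K c) ⟩
  K * suc c                            ∎
  where
  open ≤-Reasoning
  sameImage? : Decidable (λ x → f x ≡ f a)
  sameImage? x = f x ≟ᴮ f a

  inside outside : List _
  inside  = filter sameImage? (a ∷ as)
  outside = filter (∁? sameImage?) (a ∷ as)

  inFibre : length inside ≤ K
  inFibre = fibre (f a) _ (Unique.filter⁺ sameImage? unique)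
    (All.zip (All.filter⁺ sameImage? (All.map proj₁ rqs) , All.all-filter sameImage? (a ∷ as)))

  image' : AtMost c (λ y → Q y × ¬ y ≡ f a)
  image' bs unique' qbs = ≤-pred (image (f a ∷ bs)
    (All.map (λ q e → proj₂ q (sym e)) qbs ∷ unique') (proj₂ (All.head rqs) ∷ All.map proj₁ qbs))

  outsideFibre : length outside ≤ K * c
  outsideFibre = AtMost-fibres _≟ᴮ_ f c fibre image' _ (Unique.filter⁺ (∁? sameImage?) unique)
    (All.zipWith (λ ((r , q) , ne) → r , q , ne)
      (All.filter⁺ (∁? sameImage?) rqs , All.all-filter (∁? sameImage?) (a ∷ as)))

module _ {V : Set} {Adj : V → V → Set} where

  Path-suffix : ∀ {w u k ws x} → Path Adj w u k ws → x ∈ ws →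
    ∃[ k' ] ∃[ ws' ] (k' ≤ k × Path Adj x u k' ws' × ws' ⊆ ws)
  Path-suffix path@(here _ , _)     (here refl) = _ , _ , ≤-refl , path , id
  Path-suffix path@(step _ _ , _)   (here refl) = _ , _ , ≤-refl , path , id
  Path-suffix (step _ W , _ ∷ U) (there x∈) with Path-suffix (W , U) x∈
  ... | k' , ws' , k'≤k , path , ws'⊆ws = k' , ws' , m≤n⇒m≤1+n k'≤k , path , there ∘ ws'⊆ws

  Walk⇒Path : DecidableEquality V → ∀ {v u k ws} → Walk Adj v u k ws →
    ∃[ k' ] ∃[ ws' ] (k' ≤ k × Path Adj v u k' ws' × ws' ⊆ ws)
  Walk⇒Path _≟ⱽ_ (here v) = 0 , _ , z≤n , (here v , [] ∷ []) , id
  Walk⇒Path _≟ⱽ_ {v} (step e W) with Walk⇒Path _≟ⱽ_ W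
  ... | k , ws , k≤ , path , ws⊆ with DecMembership._∈?_ _≟ⱽ_ v ws
  ...   | yes v∈ws with Path-suffix path v∈ws
  ...     | k' , ws' , k'≤k , path' , ws'⊆ws =
              k' , ws' , m≤n⇒m≤1+n (≤-trans k'≤k k≤) , path' , there ∘ ws⊆ ∘ ws'⊆ws
  Walk⇒Path _≟ⱽ_ {v} (step e W) | k , ws , k≤ , (W' , U') , ws⊆ | no v∉ws =
    suc k , v ∷ ws , s≤s k≤ , (step e W' , All.¬Any⇒All¬ ws v∉ws ∷ U') ,
    λ { (here refl) → here refl ; (there y∈) → there (ws⊆ y∈) }

  Walk-from-isolated : ∀ {v u k ws} → (∀ w → ¬ Adj v w) → Walk Adj v u k ws → u ≡ v
  Walk-from-isolated isolated (here _)   = refl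
  Walk-from-isolated isolated (step e _) = ⊥-elim (isolated _ e)

  Walk-to-nonisolated : (∀ {a b} → Adj a b → Adj b a) → ∀ {v u k ws} →
    ∃ (Adj v) → Walk Adj v u k ws → ∃ (Adj u)
  Walk-to-nonisolated sym nonisolated (here _)   = nonisolated
  Walk-to-nonisolated sym _           (step e W) = Walk-to-nonisolated sym (_ , sym e) W

Walk-map : ∀ {V W : Set} {A : V → V → Set} {B : W → W → Set} (f : V → W) →
  (∀ {a b} → A a b → B (f a) (f b)) → ∀ {v u k ws} → Walk A v u k ws → Walk B (f v) (f u) k (map f ws)
Walk-map f hom (here v)   = here (f v)
Walk-map f hom (step e W) = step (hom e) (Walk-map f hom W)

funToFin-cong : ∀ {m k} {f g : Fin m → Fin k} → (∀ q → f q ≡ g q) → funToFin f ≡ funToFin g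
funToFin-cong {zero}  f≗g = refl
funToFin-cong {suc m} f≗g = cong₂ combine (f≗g zero) (funToFin-cong (f≗g ∘ suc))

module PointedWords (m k : ℕ) where

  Code : Set
  Code = Fin (m * k ^ m)

  root : Code → Fin m
  root = quotient (k ^ m)

  word : Code → Fin m → Fin k
  word i = finToFun (remainder {m} (k ^ m) i)

  encode : Fin m → (Fin m → Fin k) → Code
  encode p w = combine p (funToFin w)

  root-encode : ∀ p w → root (encode p w) ≡ p
  root-encode p w = cong proj₁ (remQuot-combine p (funToFin w))

  word-encode : ∀ p w q → word (encode p w) q ≡ w q
  word-encode p w q = begin
    finToFun (remainder {m} (k ^ m) (combine p (funToFin w))) q ≡⟨ cong (λ rq → finToFun (proj₂ rq) q) (remQuot-combine p (funToFin w)) ⟩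
    finToFun (funToFin w) q                                  ≡⟨ finToFun-funToFin w q ⟩
    w q                                                      ∎
    where open ≡-Reasoning

  Code-ext : ∀ {i j} → root i ≡ root j → (∀ q → word i q ≡ word j q) → i ≡ j
  Code-ext {i} {j} root≡ word≗ = begin
    i                                             ≡⟨ sym (combine-remQuot {m} (k ^ m) i) ⟩
    combine (root i) (remainder {m} (k ^ m) i)    ≡⟨ cong₂ combine root≡ remainder≡ ⟩
    combine (root j) (remainder {m} (k ^ m) j)    ≡⟨ combine-remQuot {m} (k ^ m) j ⟩
    j                                             ∎
    where
    open ≡-Reasoning
    remainder≡ : remainder {m} (k ^ m) i ≡ remainder {m} (k ^ m) j
    remainder≡ = trans (sym (funToFin-finToFin {m} {k} _)) (trans (funToFin-cong word≗) (funToFin-finToFin {m} {k} _))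

funToFin∘lookup-injective : ∀ {A : Set} {k} (xs : List A) {f g : A → Fin k} →
  funToFin (f ∘ lookupˡ xs) ≡ funToFin (g ∘ lookupˡ xs) → ∀ {x} → x ∈ xs → f x ≡ g x
funToFin∘lookup-injective xs {f} {g} eq x∈xs = begin
  f _                          ≡⟨ cong f (lookup-index x∈xs) ⟩
  f (lookupˡ xs (index x∈xs))  ≡⟨ sym (finToFun-funToFin (f ∘ lookupˡ xs) (index x∈xs)) ⟩
  finToFun (funToFin (f ∘ lookupˡ xs)) (index x∈xs) ≡⟨ cong (λ c → finToFun c (index x∈xs)) eq ⟩
  finToFun (funToFin (g ∘ lookupˡ xs)) (index x∈xs) ≡⟨ finToFun-funToFin (g ∘ lookupˡ xs) (index x∈xs) ⟩
  g (lookupˡ xs (index x∈xs))  ≡⟨ cong g (sym (lookup-index x∈xs)) ⟩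
  g _                          ∎
  where open ≡-Reasoning

Reach-refl : ∀ {V : Set} {Adj : V → V → Set} {π : V → ℕ} {r} v → Reach Adj π r v v
Reach-refl v = ≤-refl , 0 , _ , z≤n , (here v , [] ∷ []) , (inj₁ refl ∷ [])

WReach-refl : ∀ {V : Set} {Adj : V → V → Set} {π : V → ℕ} {r} v → WReach Adj π r v v
WReach-refl v = 0 , _ , z≤n , (here v , [] ∷ []) , (≤-refl ∷ [])

module MonotoneHomomorphism {V' V : Set} {Adj' : V' → V' → Set} {Adj : V → V → Set} {π' : V' → ℕ} {π : V → ℕ}
         (_≟ⱽ_ : DecidableEquality V) (φ : V' → V)
         (φ-hom : ∀ {a b} → Adj' a b → Adj (φ a) (φ b))
         (φ-mono : ∀ {a b} → π' a ≤ π' b → π (φ a) ≤ π (φ b)) where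

  Walk⇒image-Path : ∀ {P : V' → Set} {Q : V → Set} → (∀ {x} → P x → Q (φ x)) → ∀ {v u k ws} →
    Walk Adj' v u k ws → All P ws → ∃[ k' ] ∃[ ws' ] (k' ≤ k × Path Adj (φ v) (φ u) k' ws' × All Q ws')
  Walk⇒image-Path P⇒Q W all-P with Walk⇒Path _≟ⱽ_ (Walk-map φ φ-hom W)
  ... | k' , ws' , k'≤k , path , ws'⊆ =
    k' , ws' , k'≤k , path , All.tabulate (λ y∈ → All.lookup (All.map⁺ (All.map P⇒Q all-P)) (ws'⊆ y∈))

  Reach-map : ∀ {r v u} → Reach Adj' π' r v u → Reach Adj π r (φ v) (φ u)
  Reach-map {r} {v} {u} (u≤v , k , ws , k≤r , (W , _) , all-P) with Walk⇒image-Path P⇒Q W all-P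
    where
    P⇒Q : ∀ {x} → x ≡ u ⊎ π' v ≤ π' x → φ x ≡ φ u ⊎ π (φ v) ≤ π (φ x)
    P⇒Q (inj₁ refl) = inj₁ refl
    P⇒Q (inj₂ v≤x)  = inj₂ (φ-mono v≤x)
  ... | k' , ws' , k'≤k , path , all-Q = φ-mono u≤v , k' , ws' , ≤-trans k'≤k k≤r , path , all-Q

  WReach-map : ∀ {r v u} → WReach Adj' π' r v u → WReach Adj π r (φ v) (φ u)
  WReach-map (k , ws , k≤r , (W , _) , all-P) with Walk⇒image-Path φ-mono W all-P
  ... | k' , ws' , k'≤k , path , all-Q = k' , ws' , ≤-trans k'≤k k≤r , path , all-Q

  -- Isolated vertices only reach themselves; the others reach only non-isolated vertices,
  -- which are then counted through their images, K per image.
  MaxCountLe-fibres : ∀ {R' : V' → V' → Set} {R : V → V → Set} {K c} →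
    (∀ {v u} → R' v u → R (φ v) (φ u)) → (∀ {v u} → R' v u → ∃[ k ] ∃[ ws ] Walk Adj' v u k ws) →
    (∀ x → R x x) → (∀ {a b} → Adj' a b → Adj' b a) → (∀ x → (∀ y → ¬ Adj' x y) ⊎ ∃ (Adj' x)) →
    0 < K → (∀ b → AtMost K (λ a → ∃ (Adj' a) × φ a ≡ b)) → MaxCountLe R c → MaxCountLe R' (K * c)
  MaxCountLe-fibres {K = K} {c} R'⇒R R'⇒Walk R-refl sym isolated? 0<K fibre maxR v us unique all-R'
    with isolated? v
  ... | inj₂ nonisolated =
    AtMost-fibres _≟ⱽ_ φ c fibre (maxR (φ v)) us unique
      (All.map (λ r → Walk-to-nonisolated sym nonisolated (proj₂ (proj₂ (R'⇒Walk r))) , R'⇒R r) all-R')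
  ... | inj₁ isolated = begin
    length us ≤⟨ AtMost-≡ v us unique (All.map (λ r → Walk-from-isolated isolated (proj₂ (proj₂ (R'⇒Walk r)))) all-R') ⟩
    1         ≤⟨ *-mono-≤ 0<K (maxR (φ v) (φ v ∷ []) ([] ∷ []) (R-refl (φ v) ∷ [])) ⟩
    K * c     ∎
    where open ≤-Reasoning


Letter : Set
Letter = Fin 3

pattern free    = zero
pattern inward  = suc zero
pattern outward = suc (suc zero)

does≡true⇒ : ∀ {A : Set} (a? : Dec A) → does a? ≡ true → A
does≡true⇒ (yes a) _ = a

≡true⇒≢false : ∀ {b} → b ≡ true → ¬ b ≡ false
≡true⇒≢false refl ()

letterWeight : Letter → ℕ
letterWeight ℓ = suc (toℕ ℓ)

letterWeight-injective : ∀ {ℓ ℓ'} → letterWeight ℓ ≡ letterWeight ℓ' → ℓ ≡ ℓ'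
letterWeight-injective = toℕ-injective ∘ suc-injective

sameDirection : ∀ {o i o' i'} → (o ∨ i) ≡ true → (o' ∨ i') ≡ true →
  ¬ ((i ≡ true × o' ≡ true) ⊎ (o ≡ true × i' ≡ true)) →
  ((o ≡ true × i ≡ false) × (o' ≡ true × i' ≡ false)) ⊎ ((i ≡ true × o ≡ false) × (i' ≡ true × o' ≡ false))
sameDirection {true}  {false} {true}  {false} _ _ _ = inj₁ ((refl , refl) , (refl , refl))
sameDirection {false} {true}  {false} {true}  _ _ _ = inj₂ ((refl , refl) , (refl , refl))
sameDirection {_}     {true}  {true}  {_}     _ _ notD = ⊥-elim (notD (inj₁ (refl , refl)))
sameDirection {true}  {_}     {_}     {true}  _ _ notD = ⊥-elim (notD (inj₂ (refl , refl)))
sameDirection {false} {false} {_}     {_}     () _ _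
sameDirection {_}     {_}     {false} {false} _ () _

module Construction {n m : ℕ} (G : SimpleGraph n) (L : DBipGraph n m) (π : Fin n ⊎ Fin m → ℕ)
                    (dl : IsDirLaconDecomp G L π) where
  open DBipGraph L
  open PointedWords m 3

  πᴴ : Fin m → ℕ
  πᴴ q = π (inj₂ q)

  πᴴ-injective : ∀ {p q} → πᴴ p ≡ πᴴ q → p ≡ q
  πᴴ-injective eq = inj₂-injective (proj₁ dl eq)

  Adjacent : Fin n → Fin m → Set
  Adjacent t q = DBipAdj L (inj₁ t) (inj₂ q)

  OnlyIn OnlyOut : Fin n → Fin m → Set
  OnlyIn  t q = inn t q ≡ true × out t q ≡ false
  OnlyOut t q = out t q ≡ true × inn t q ≡ false

  inn⇒adjacent : ∀ {t q} → inn t q ≡ true → Adjacent t q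
  inn⇒adjacent {t} {q} inn≡true = trans (cong (out t q ∨_) inn≡true) (∨-zeroʳ (out t q))

  out⇒adjacent : ∀ {t q} → out t q ≡ true → Adjacent t q
  out⇒adjacent {t} {q} out≡true = cong (_∨ inn t q) out≡true

  D⇒adjacent : ∀ {t t' q} → DSet L t t' q → Adjacent t q × Adjacent t' q
  D⇒adjacent (inj₁ (inn≡true , out'≡true)) = inn⇒adjacent inn≡true , out⇒adjacent out'≡true
  D⇒adjacent (inj₂ (out≡true , inn'≡true)) = out⇒adjacent out≡true , inn⇒adjacent inn'≡true

  D⇒¬bothOnlyIn : ∀ {t t' q} → DSet L t t' q → ¬ (OnlyIn t q × OnlyIn t' q)
  D⇒¬bothOnlyIn (inj₁ (_ , out'≡true)) (_ , (_ , out'≡false)) = ≡true⇒≢false out'≡true out'≡false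
  D⇒¬bothOnlyIn (inj₂ (out≡true , _)) ((_ , out≡false) , _) = ≡true⇒≢false out≡true out≡false

  D⇒¬bothOnlyOut : ∀ {t t' q} → DSet L t t' q → ¬ (OnlyOut t q × OnlyOut t' q)
  D⇒¬bothOnlyOut (inj₁ (inn≡true , _)) ((_ , inn≡false) , _) = ≡true⇒≢false inn≡true inn≡false
  D⇒¬bothOnlyOut (inj₂ (_ , inn'≡true)) (_ , (_ , inn'≡false)) = ≡true⇒≢false inn'≡true inn'≡false

  adjacent? : ∀ t q → Dec (Adjacent t q)
  adjacent? t q = (out t q ∨ inn t q) ≟ᵇ true

  D? : ∀ t t' q → Dec (DSet L t t' q)
  D? t t' q = ((inn t q ≟ᵇ true) ×-dec (out t' q ≟ᵇ true)) ⊎-dec ((out t q ≟ᵇ true) ×-dec (inn t' q ≟ᵇ true))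

  onlyIn? : ∀ t q → Dec (OnlyIn t q)
  onlyIn? t q = (inn t q ≟ᵇ true) ×-dec (out t q ≟ᵇ false)

  onlyOut? : ∀ t q → Dec (OnlyOut t q)
  onlyOut? t q = (out t q ≟ᵇ true) ×-dec (inn t q ≟ᵇ false)

  Allows : Fin n → Fin m → Letter → Set
  Allows t q free    = ⊤
  Allows t q inward  = OnlyIn t q
  Allows t q outward = OnlyOut t q

  allows? : ∀ t q ℓ → Dec (Allows t q ℓ)
  allows? t q free    = yes tt
  allows? t q inward  = onlyIn? t q
  allows? t q outward = onlyOut? t q

  -- The code i stands for a copy of root i whose target neighbours are restricted, at each
  -- later hidden vertex q, to the arc pattern prescribed by word i q; earlier letters carry
  -- no information and Canonical fixes them to free.
  Canonical : Code → Set
  Canonical i = ∀ q → πᴴ q ≤ πᴴ (root i) → word i q ≡ free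

  Joins : Fin n → Code → Set
  Joins t i = Adjacent t (root i) × (∀ q → πᴴ (root i) < πᴴ q → Allows t q (word i q))

  Edge : Fin n → Code → Set
  Edge t i = Canonical i × Joins t i

  canonical? : ∀ i → Dec (Canonical i)
  canonical? i = all? (λ q → (πᴴ q ≤? πᴴ (root i)) →-dec (word i q ≟ᶠ free))

  joins? : ∀ t i → Dec (Joins t i)
  joins? t i = adjacent? t (root i) ×-dec all? (λ q → (πᴴ (root i) <? πᴴ q) →-dec allows? t q (word i q))

  edge? : ∀ t i → Dec (Edge t i)
  edge? t i = canonical? i ×-dec joins? t i

  L' : BipGraph n (m * 3 ^ m)
  L' = record { E = λ t i → does (edge? t i) ; label = λ i → label (root i) }

  Adj' : Fin n ⊎ Code → Fin n ⊎ Code → Set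
  Adj' = BipAdj L'

  edge-sound : ∀ {t i} → Adj' (inj₁ t) (inj₂ i) → Edge t i
  edge-sound {t} {i} = does≡true⇒ (edge? t i)

  edge-complete : ∀ {t i} → Edge t i → Adj' (inj₁ t) (inj₂ i)
  edge-complete {t} {i} = dec-true (edge? t i)

  Adj'-sym : ∀ {a b} → Adj' a b → Adj' b a
  Adj'-sym {inj₁ _} {inj₂ _} e = e
  Adj'-sym {inj₂ _} {inj₁ _} e = e

  -- Read from the π-latest hidden vertex downwards, weights order codes lexicographically;
  -- a weight ≥ 2 marks the root or a constrained letter.
  weight : Code → Fin m → ℕ
  weight i q with <-cmp (πᴴ (root i)) (πᴴ q)
  ... | tri< _ _ _ = letterWeight (word i q)
  ... | tri≈ _ _ _ = 2
  ... | tri> _ _ _ = 0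

  weight-above : ∀ {i q} → πᴴ (root i) < πᴴ q → weight i q ≡ letterWeight (word i q)
  weight-above {i} {q} root<q with <-cmp (πᴴ (root i)) (πᴴ q)
  ... | tri< _ _ _   = refl
  ... | tri≈ _ eq _  = ⊥-elim (<⇒≢ root<q eq)
  ... | tri> _ _ q<root = ⊥-elim (<-asym root<q q<root)

  weight-root : ∀ i → weight i (root i) ≡ 2
  weight-root i with <-cmp (πᴴ (root i)) (πᴴ (root i))
  ... | tri< lt _ _ = ⊥-elim (<-irrefl refl lt)
  ... | tri≈ _ _ _  = refl
  ... | tri> _ _ gt = ⊥-elim (<-irrefl refl gt)

  weight<4 : ∀ i q → weight i q < 4
  weight<4 i q with <-cmp (πᴴ (root i)) (πᴴ q)
  ... | tri< _ _ _ = s≤s (toℕ<n (word i q))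
  ... | tri≈ _ _ _ = s≤s (s≤s (s≤s z≤n))
  ... | tri> _ _ _ = s≤s z≤n

  allows⇒adjacent : ∀ {t q} ℓ → Allows t q ℓ → 2 ≤ letterWeight ℓ → Adjacent t q
  allows⇒adjacent free    _         (s≤s ())
  allows⇒adjacent inward  (inn≡true , _) _ = inn⇒adjacent inn≡true
  allows⇒adjacent outward (out≡true , _) _ = out⇒adjacent out≡true

  heavy⇒adjacent : ∀ {t i q} → Joins t i → 2 ≤ weight i q → Adjacent t q
  heavy⇒adjacent {t} {i} {q} (adjacent , allows) heavy with <-cmp (πᴴ (root i)) (πᴴ q)
  ... | tri< root<q _ _ = allows⇒adjacent (word i q) (allows q root<q) heavy
  ... | tri≈ _ eq _     = subst (Adjacent t) (πᴴ-injective eq) adjacent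
  ... | tri> _ _ _      = ⊥-elim (<⇒≱ (s≤s z≤n) heavy)

  topSpec : ∀ i → ∃ λ q → 2 ≤ weight i q × (∀ q' → 2 ≤ weight i q' → πᴴ q' ≤ πᴴ q)
  topSpec i = argmax πᴴ (λ q → 2 ≤? weight i q) (root i , ≤-reflexive (sym (weight-root i)))

  top : Code → Fin m
  top i = proj₁ (topSpec i)

  top-heavy : ∀ i → 2 ≤ weight i (top i)
  top-heavy i = proj₁ (proj₂ (topSpec i))

  top-max : ∀ i q → 2 ≤ weight i q → πᴴ q ≤ πᴴ (top i)
  top-max i = proj₂ (proj₂ (topSpec i))

  root≤top : ∀ i → πᴴ (root i) ≤ πᴴ (top i)
  root≤top i = top-max i (root i) (≤-reflexive (sym (weight-root i)))

  light-above-top : ∀ i q → πᴴ (top i) < πᴴ q → weight i q < 2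
  light-above-top i q top<q = ≰⇒> (λ heavy → <⇒≱ top<q (top-max i q heavy))

  joins⇒adjacent-top : ∀ {t i} → Joins t i → Adjacent t (top i)
  joins⇒adjacent-top {i = i} joins = heavy⇒adjacent joins (top-heavy i)

  open Lexicographic πᴴ πᴴ-injective 4

  rank : Code → ℕ
  rank i = value (weight i)

  rank-lex : ∀ i j q₀ → weight i q₀ < weight j q₀ →
    (∀ q → πᴴ q₀ < πᴴ q → weight i q ≤ weight j q) → rank i < rank j
  rank-lex i j = value-lex (weight<4 i)

  top-rank : ∀ i j → πᴴ (top j) < πᴴ (top i) → rank j < rank i
  top-rank i j top-j<top-i =
    rank-lex j i (top i) (<-≤-trans (light-above-top j (top i) top-j<top-i) (top-heavy i)) light≤
    where
    light≤ : ∀ q → πᴴ (top i) < πᴴ q → weight j q ≤ weight i q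
    light≤ q top-i<q = begin
      weight j q                ≤⟨ ≤-pred (light-above-top j q (<-trans top-j<top-i top-i<q)) ⟩
      1                         ≤⟨ s≤s z≤n ⟩
      letterWeight (word i q)   ≡⟨ sym (weight-above (≤-<-trans (root≤top i) top-i<q)) ⟩
      weight i q                ∎
      where open ≤-Reasoning

  π' : Fin n ⊎ Code → ℕ
  π' (inj₁ t) = 4 ^ supremum πᴴ * (m * 3 ^ m) + π (inj₁ t)
  π' (inj₂ i) = rank i * (m * 3 ^ m) + toℕ i

  π'-hidden<target : ∀ i t → π' (inj₂ i) < π' (inj₁ t)
  π'-hidden<target i t = m*b+x<n*b+y (toℕ<n i) (value< (weight<4 i))

  π'-rank : ∀ i j → rank i < rank j → π' (inj₂ i) < π' (inj₂ j)
  π'-rank i j = m*b+x<n*b+y (toℕ<n i)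

  π'-injective : IsLinearOrder π'
  π'-injective {inj₁ t} {inj₁ t'} eq = cong inj₁ (inj₁-injective (proj₁ dl (+-cancelˡ-≡ _ _ _ eq)))
  π'-injective {inj₁ t} {inj₂ j}  eq = ⊥-elim (<⇒≢ (π'-hidden<target j t) (sym eq))
  π'-injective {inj₂ i} {inj₁ t}  eq = ⊥-elim (<⇒≢ (π'-hidden<target i t) eq)
  π'-injective {inj₂ i} {inj₂ j}  eq = cong inj₂ (toℕ-injective (m*b+x≡n*b+y⇒x≡y {rank i} {rank j} (toℕ<n i) (toℕ<n j) eq))

  φ : Fin n ⊎ Code → Fin n ⊎ Fin m
  φ (inj₁ t) = inj₁ t
  φ (inj₂ i) = inj₂ (top i)

  φ-mono : ∀ {a b} → π' a ≤ π' b → π (φ a) ≤ π (φ b)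
  φ-mono {inj₁ t} {inj₁ t'} le = +-cancelˡ-≤ _ _ _ le
  φ-mono {inj₁ t} {inj₂ j}  le = ⊥-elim (<⇒≱ (π'-hidden<target j t) le)
  φ-mono {inj₂ i} {inj₁ t}  le = <⇒≤ (proj₁ (proj₂ dl) (top i) t)
  φ-mono {inj₂ i} {inj₂ j}  le = ≮⇒≥ (λ top-j<top-i → <⇒≱ (π'-rank j i (top-rank i j top-j<top-i)) le)

  φ-hom : ∀ {a b} → Adj' a b → DBipAdj L (φ a) (φ b)
  φ-hom {inj₁ t} {inj₂ i} e = joins⇒adjacent-top (proj₂ (edge-sound e))
  φ-hom {inj₂ i} {inj₁ t} e = joins⇒adjacent-top (proj₂ (edge-sound e))

  module Dominant (t t' : Fin n) where

    dSpec : ∃ λ d → DSet L t t' d × (∀ q → DSet L t t' q → πᴴ q ≤ πᴴ d)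
    dSpec = argmax πᴴ (D? t t') (proj₁ (proj₂ (proj₂ dl)) t t')

    d : Fin m
    d = proj₁ dSpec

    d∈D : DSet L t t' d
    d∈D = proj₁ (proj₂ dSpec)

    d-max : ∀ q → DSet L t t' q → πᴴ q ≤ πᴴ d
    d-max = proj₂ (proj₂ dSpec)

    starLetter : Fin m → Letter
    starLetter q with πᴴ d <? πᴴ q | onlyOut? t q ×-dec onlyOut? t' q | onlyIn? t q ×-dec onlyIn? t' q
    ... | no _  | _     | _     = free
    ... | yes _ | yes _ | _     = outward
    ... | yes _ | no _  | yes _ = inward
    ... | yes _ | no _  | no _  = free

    starLetter-below : ∀ q → πᴴ q ≤ πᴴ d → starLetter q ≡ free
    starLetter-below q q≤d with πᴴ d <? πᴴ q
    ... | yes d<q = ⊥-elim (<⇒≱ d<q q≤d)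
    ... | no _    = refl

    starLetter-allows : ∀ q → Allows t q (starLetter q) × Allows t' q (starLetter q)
    starLetter-allows q with πᴴ d <? πᴴ q | onlyOut? t q ×-dec onlyOut? t' q | onlyIn? t q ×-dec onlyIn? t' q
    ... | no _  | _          | _        = tt , tt
    ... | yes _ | yes outOut | _        = outOut
    ... | yes _ | no _       | yes inIn = inIn
    ... | yes _ | no _       | no _     = tt , tt

    starLetter-out : ∀ q → πᴴ d < πᴴ q → OnlyOut t q × OnlyOut t' q → starLetter q ≡ outward
    starLetter-out q d<q outOut with πᴴ d <? πᴴ q | onlyOut? t q ×-dec onlyOut? t' q
    ... | no d≮q | _           = ⊥-elim (d≮q d<q)
    ... | yes _  | yes _       = refl
    ... | yes _  | no ¬outOut  = ⊥-elim (¬outOut outOut)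

    starLetter-in : ∀ q → πᴴ d < πᴴ q → OnlyIn t q × OnlyIn t' q → starLetter q ≡ inward
    starLetter-in q d<q inIn@((_ , out≡false) , _)
      with πᴴ d <? πᴴ q | onlyOut? t q ×-dec onlyOut? t' q | onlyIn? t q ×-dec onlyIn? t' q
    ... | no d≮q | _                        | _        = ⊥-elim (d≮q d<q)
    ... | yes _  | yes ((out≡true , _) , _) | _        = ⊥-elim (≡true⇒≢false out≡true out≡false)
    ... | yes _  | no _                     | yes _    = refl
    ... | yes _  | no _                     | no ¬inIn = ⊥-elim (¬inIn inIn)

    star : Code
    star = encode d starLetter

    star-root : root star ≡ d
    star-root = root-encode d starLetter

    star-word : ∀ q → word star q ≡ starLetter q
    star-word = word-encode d starLetter

    d<⇒root-star< : ∀ {q} → πᴴ d < πᴴ q → πᴴ (root star) < πᴴ q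
    d<⇒root-star< {q} = subst (λ p → πᴴ p < πᴴ q) (sym star-root)

    star-canonical : Canonical star
    star-canonical q q≤root =
      trans (star-word q) (starLetter-below q (subst (λ p → πᴴ q ≤ πᴴ p) star-root q≤root))

    star-common : CommonNb L' t t' star
    star-common =
      edge-complete (star-canonical , subst (Adjacent t) (sym star-root) (proj₁ (D⇒adjacent d∈D)) ,
                     λ q _ → subst (Allows t q) (sym (star-word q)) (proj₁ (starLetter-allows q))) ,
      edge-complete (star-canonical , subst (Adjacent t') (sym star-root) (proj₂ (D⇒adjacent d∈D)) ,
                     λ q _ → subst (Allows t' q) (sym (star-word q)) (proj₂ (starLetter-allows q)))

    star-weight-above : ∀ q → πᴴ d < πᴴ q → weight star q ≡ letterWeight (starLetter q)
    star-weight-above q d<q = trans (weight-above (d<⇒root-star< d<q)) (cong letterWeight (star-word q))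

    star-weight-d : weight star d ≡ 2
    star-weight-d = subst (λ p → weight star p ≡ 2) star-root (weight-root star)

    shared⇒heavy : ∀ q → πᴴ d < πᴴ q → Adjacent t q → Adjacent t' q → 2 ≤ letterWeight (starLetter q)
    shared⇒heavy q d<q adjacent adjacent' with sameDirection adjacent adjacent' (λ q∈D → <⇒≱ d<q (d-max q q∈D))
    ... | inj₁ outOut = subst (λ ℓ → 2 ≤ letterWeight ℓ) (sym (starLetter-out q d<q outOut)) (s≤s (s≤s z≤n))
    ... | inj₂ inIn   = subst (λ ℓ → 2 ≤ letterWeight ℓ) (sym (starLetter-in q d<q inIn)) (s≤s (s≤s z≤n))

    allowed≤starLetter : ∀ q → πᴴ d < πᴴ q → ∀ ℓ → Allows t q ℓ → Allows t' q ℓ →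
      letterWeight ℓ ≤ letterWeight (starLetter q)
    allowed≤starLetter q d<q free    _       _        = s≤s z≤n
    allowed≤starLetter q d<q inward  onlyIn  onlyIn'  = ≤-reflexive (cong letterWeight (sym (starLetter-in q d<q (onlyIn , onlyIn'))))
    allowed≤starLetter q d<q outward onlyOut onlyOut' = ≤-reflexive (cong letterWeight (sym (starLetter-out q d<q (onlyOut , onlyOut'))))

    -- Above d, star carries the heaviest letter that any common neighbour of t and t' can carry.
    module _ {i : Code} (canonical : Canonical i) (joins : Joins t i) (joins' : Joins t' i) where

      weight≤star : ∀ q → πᴴ d < πᴴ q → weight i q ≤ weight star q
      weight≤star q d<q = subst (weight i q ≤_) (sym (star-weight-above q d<q)) weight≤starLetter
        where
        weight≤starLetter : weight i q ≤ letterWeight (starLetter q)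
        weight≤starLetter with <-cmp (πᴴ (root i)) (πᴴ q)
        ... | tri< root<q _ _ = allowed≤starLetter q d<q (word i q) (proj₂ joins q root<q) (proj₂ joins' q root<q)
        ... | tri≈ _ eq _     = shared⇒heavy q d<q (subst (Adjacent t) (πᴴ-injective eq) (proj₁ joins))
                                                   (subst (Adjacent t') (πᴴ-injective eq) (proj₁ joins'))
        ... | tri> _ _ _      = z≤n

      light-at-d : ¬ root i ≡ d → weight i d < 2
      light-at-d root≢d with <-cmp (πᴴ (root i)) (πᴴ d)
      ... | tri< root<d _ _ = unshared (word i d) (proj₂ joins d root<d) (proj₂ joins' d root<d)
        where
        unshared : ∀ ℓ → Allows t d ℓ → Allows t' d ℓ → letterWeight ℓ < 2
        unshared free    _       _        = s≤s (s≤s z≤n)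
        unshared inward  onlyIn  onlyIn'  = ⊥-elim (D⇒¬bothOnlyIn d∈D (onlyIn , onlyIn'))
        unshared outward onlyOut onlyOut' = ⊥-elim (D⇒¬bothOnlyOut d∈D (onlyOut , onlyOut'))
      ... | tri≈ _ eq _     = ⊥-elim (root≢d (πᴴ-injective eq))
      ... | tri> _ _ _      = s≤s z≤n

      below-star : rank i < rank star ⊎ i ≡ star
      below-star with any? (λ q → (πᴴ d <? πᴴ q) ×-dec (weight i q <? weight star q))
      ... | yes (q₀ , d<q₀ , lt) = inj₁ (rank-lex i star q₀ lt (λ q q₀<q → weight≤star q (<-trans d<q₀ q₀<q)))
      ... | no noStrict with root i ≟ᶠ d
      ...   | no root≢d  = inj₁ (rank-lex i star d (subst (weight i d <_) (sym star-weight-d) (light-at-d root≢d)) weight≤star)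
      ...   | yes root≡d = inj₂ (Code-ext (trans root≡d (sym star-root)) sameWord)
        where
        sameWord : ∀ q → word i q ≡ word star q
        sameWord q with πᴴ d <? πᴴ q
        ... | no d≮q = trans (canonical q (subst (λ p → πᴴ q ≤ πᴴ p) (sym root≡d) (≮⇒≥ d≮q)))
                             (sym (star-canonical q (subst (λ p → πᴴ q ≤ πᴴ p) (sym star-root) (≮⇒≥ d≮q))))
        ... | yes d<q = letterWeight-injective (begin
          letterWeight (word i q)    ≡⟨ sym (weight-above (subst (λ p → πᴴ p < πᴴ q) (sym root≡d) d<q)) ⟩
          weight i q                 ≡⟨ ≤-antisym (weight≤star q d<q) (≮⇒≥ (λ lt → noStrict (q , d<q , lt))) ⟩
          weight star q              ≡⟨ weight-above (d<⇒root-star< d<q) ⟩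
          letterWeight (word star q) ∎)
          where open ≡-Reasoning

    dominant≡star : ∀ h → IsDominant π' (CommonNb L' t t') h → h ≡ star
    dominant≡star h ((e , e') , max) with edge-sound e | edge-sound e'
    ... | canonical , joins | _ , joins' with below-star canonical joins joins'
    ...   | inj₁ rank<   = ⊥-elim (<⇒≱ (π'-rank h star rank<) (max star star-common))
    ...   | inj₂ h≡star  = h≡star

    dominant-label : ¬ t ≡ t' → ∀ h → IsDominant π' (CommonNb L' t t') h →
      SimpleGraph.Adj G t t' ⇔ label (root h) ≡ true
    dominant-label t≢t' h dominant =
      subst (λ p → SimpleGraph.Adj G t t' ⇔ label p ≡ true)
        (sym (trans (cong root (dominant≡star h dominant)) star-root))
        (proj₂ (proj₂ (proj₂ dl)) t t' t≢t' d (d∈D , d-max))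

  isLacon : IsLaconDecomp G L' π'
  isLacon = π'-injective , π'-hidden<target ,
            (λ t t' → Dominant.star t t' , Dominant.star-common t t') , Dominant.dominant-label

  open import Data.List.Membership.DecPropositional (_≟ᶠ_ {m}) using (_∈?_)

  Nearby : Fin m → Fin m → Set
  Nearby h q = q ≡ h ⊎ (πᴴ q < πᴴ h × ∃ λ t → Adjacent t q × Adjacent t h)

  nearby? : ∀ h q → Dec (Nearby h q)
  nearby? h q = (q ≟ᶠ h) ⊎-dec ((πᴴ q <? πᴴ h) ×-dec
    any? (λ t → adjacent? t q ×-dec adjacent? t h))

  nearby : Fin m → List (Fin m)
  nearby h = filter (nearby? h) (allFin m)

  nearby-intro : ∀ {t h q} → Adjacent t q → Adjacent t h → πᴴ q ≤ πᴴ h → q ∈ nearby h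
  nearby-intro {t} {h} {q} adjacent-q adjacent-h q≤h = ∈-filter⁺ (nearby? h) (∈-allFin q) near
    where
    near : Nearby h q
    near with q ≟ᶠ h
    ... | yes q≡h = inj₁ q≡h
    ... | no q≢h  = inj₂ (≤∧≢⇒< q≤h (q≢h ∘ πᴴ-injective) , t , adjacent-q , adjacent-h)

  nearby-reach : ∀ {h q} → Nearby h q → Reach (DBipAdj L) π 2 (inj₂ h) (inj₂ q)
  nearby-reach (inj₁ refl) = Reach-refl _
  nearby-reach {h} {q} (inj₂ (q<h , t , adjacent-q , adjacent-h)) =
    <⇒≤ q<h , 2 , _ , ≤-refl , (step adjacent-h (step adjacent-q (here _)) , unique) ,
    (inj₂ ≤-refl ∷ inj₂ (<⇒≤ (proj₁ (proj₂ dl) h t)) ∷ inj₁ refl ∷ [])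
    where
    unique : Unique (inj₂ h ∷ inj₁ t ∷ inj₂ q ∷ [])
    unique = ((λ ()) ∷ (λ h≡q → <⇒≢ q<h (sym (cong π h≡q))) ∷ []) ∷ ((λ ()) ∷ []) ∷ [] ∷ []

  length-nearby : ∀ {c₂} → ColLe (DBipAdj L) π 2 c₂ → ∀ h → length (nearby h) ≤ c₂
  length-nearby {c₂} col₂ h = subst (_≤ c₂) (length-map inj₂ (nearby h))
    (col₂ (inj₂ h) (map inj₂ (nearby h))
      (Unique.map⁺ inj₂-injective (Unique.filter⁺ (nearby? h) (Unique.allFin⁺ m)))
      (All.map⁺ (All.tabulate (λ q∈ → nearby-reach (proj₂ (∈-filter⁻ (nearby? h) {xs = allFin m} q∈))))))

  heavy⇒nearby : ∀ {t i q} → Joins t i → 2 ≤ weight i q → q ∈ nearby (top i)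
  heavy⇒nearby {i = i} {q} joins heavy =
    nearby-intro (heavy⇒adjacent joins heavy) (joins⇒adjacent-top joins) (top-max i q heavy)

  far-free : ∀ {t i q} → Joins t i → ¬ q ∈ nearby (top i) → πᴴ (root i) < πᴴ q → word i q ≡ free
  far-free {i = i} {q} joins far root<q with word i q | weight-above {i} {q} root<q
  ... | free    | _      = refl
  ... | inward  | weight≡ = ⊥-elim (far (heavy⇒nearby joins (≤-reflexive (sym weight≡))))
  ... | outward | weight≡ = ⊥-elim (far (heavy⇒nearby joins (subst (2 ≤_) (sym weight≡) (s≤s (s≤s z≤n)))))

  -- fromℕ 3 marks the root; in a fibre of φ over h, a code is determined by its signature on nearby h.
  signature : Code → Fin m → Fin 4
  signature i q with q ≟ᶠ root i
  ... | yes _ = fromℕ 3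
  ... | no _ with πᴴ (root i) <? πᴴ q
  ...   | yes _ = inject₁ (word i q)
  ...   | no _  = zero

  signature-root : ∀ i → signature i (root i) ≡ fromℕ 3
  signature-root i with root i ≟ᶠ root i
  ... | yes _     = refl
  ... | no r≢r    = ⊥-elim (r≢r refl)

  signature≡fromℕ⇒root : ∀ i q → signature i q ≡ fromℕ 3 → q ≡ root i
  signature≡fromℕ⇒root i q eq with q ≟ᶠ root i
  ... | yes q≡root = q≡root
  ... | no _ with πᴴ (root i) <? πᴴ q
  ...   | yes _ = ⊥-elim (fromℕ≢inject₁ (sym eq))
  signature≡fromℕ⇒root i q () | no _ | no _

  signature-above : ∀ i q → πᴴ (root i) < πᴴ q → signature i q ≡ inject₁ (word i q)
  signature-above i q root<q with q ≟ᶠ root i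
  ... | yes refl = ⊥-elim (<-irrefl refl root<q)
  ... | no _ with πᴴ (root i) <? πᴴ q
  ...   | yes _       = refl
  ...   | no root≮q   = ⊥-elim (root≮q root<q)

  fibre-injective : ∀ {t t' i i'} → Edge t i → Edge t' i' → top i' ≡ top i →
    (∀ {q} → q ∈ nearby (top i) → signature i q ≡ signature i' q) → i ≡ i'
  fibre-injective {i = i} {i'} (canonical , joins) (canonical' , joins') top≡ same = Code-ext root≡ sameWord
    where
    root≡ : root i ≡ root i'
    root≡ = signature≡fromℕ⇒root i' (root i) (trans (sym (same
      (nearby-intro (proj₁ joins) (joins⇒adjacent-top joins) (root≤top i)))) (signature-root i))

    sameWord : ∀ q → word i q ≡ word i' q
    sameWord q with πᴴ (root i) <? πᴴ q
    ... | no root≮q = trans (canonical q (≮⇒≥ root≮q))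
                            (sym (canonical' q (subst (λ p → πᴴ q ≤ πᴴ p) root≡ (≮⇒≥ root≮q))))
    ... | yes root<q with q ∈? nearby (top i)
    ...   | yes near = inject₁-injective (begin
      inject₁ (word i q)  ≡⟨ sym (signature-above i q root<q) ⟩
      signature i q       ≡⟨ same near ⟩
      signature i' q      ≡⟨ signature-above i' q root'<q ⟩
      inject₁ (word i' q) ∎)
      where
      open ≡-Reasoning
      root'<q = subst (λ p → πᴴ p < πᴴ q) root≡ root<q
    ...   | no far = trans (far-free joins far root<q)
      (sym (far-free joins' (subst (λ p → ¬ q ∈ nearby p) (sym top≡) far) (subst (λ p → πᴴ p < πᴴ q) root≡ root<q)))

  fibre : ∀ {c₂} → ColLe (DBipAdj L) π 2 c₂ → ∀ b → AtMost (4 ^ c₂) (λ a → ∃ (Adj' a) × φ a ≡ b)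
  fibre {c₂} _ (inj₁ t) xs unique inFibre =
    ≤-trans (AtMost-≡ (inj₁ t) xs unique (All.map target-fibre inFibre)) (m^n>0 4 c₂)
    where
    target-fibre : ∀ {a} → ∃ (Adj' a) × φ a ≡ inj₁ t → a ≡ inj₁ t
    target-fibre {inj₁ _} (_ , refl) = refl
    target-fibre {inj₂ _} (_ , ())
  fibre {c₂} col₂ (inj₂ h) xs unique inFibre =
    ≤-trans (length≤-injection xs unique code injective) (^-monoʳ-≤ 4 (length-nearby col₂ h))
    where
    code : Fin n ⊎ Code → Fin (4 ^ length (nearby h))
    code (inj₁ _) = funToFin {length (nearby h)} {4} (λ _ → zero)
    code (inj₂ i) = funToFin (signature i ∘ lookupˡ (nearby h))

    injective : ∀ {a b} → a ∈ xs → b ∈ xs → code a ≡ code b → a ≡ b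
    injective {inj₁ _} a∈ _ _ with All.lookup inFibre a∈
    ... | _ , ()
    injective {inj₂ _} {inj₁ _} _ b∈ _ with All.lookup inFibre b∈
    ... | _ , ()
    injective {inj₂ i} {inj₂ i'} a∈ b∈ eq with All.lookup inFibre a∈ | All.lookup inFibre b∈
    ... | (inj₁ t , e) , top≡h | (inj₁ t' , e') , top'≡h = cong inj₂
      (fibre-injective (edge-sound e) (edge-sound e') (inj₂-injective (trans top'≡h (sym top≡h)))
        (subst (λ p → ∀ {q} → q ∈ nearby p → _) (sym (inj₂-injective top≡h))
          (funToFin∘lookup-injective (nearby h) {signature i} {signature i'} eq)))

  isolated? : ∀ x → (∀ y → ¬ Adj' x y) ⊎ ∃ (Adj' x)
  isolated? (inj₁ t) = inj₂ (inj₂ (Dominant.star t t) , proj₁ (Dominant.star-common t t))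
  isolated? (inj₂ i) with any? (λ t → does (edge? t i) ≟ᵇ true)
  ... | yes (t , e) = inj₂ (inj₁ t , e)
  ... | no none     = inj₁ λ { (inj₁ t) e → none (t , e) ; (inj₂ _) () }

  open MonotoneHomomorphism {Adj' = Adj'} {DBipAdj L} {π'} {π} (≡-dec _≟ᶠ_ _≟ᶠ_) φ φ-hom φ-mono

  col-bound : ∀ {r c₂ c} → ColLe (DBipAdj L) π 2 c₂ → ColLe (DBipAdj L) π r c → ColLe Adj' π' r (4 ^ c₂ * c)
  col-bound {c₂ = c₂} col₂ = MaxCountLe-fibres Reach-map (λ (_ , k , ws , _ , (W , _) , _) → k , ws , W)
    Reach-refl Adj'-sym isolated? (m^n>0 4 c₂) (fibre col₂)

  wcol-bound : ∀ {r c₂ w} → ColLe (DBipAdj L) π 2 c₂ → WColLe (DBipAdj L) π r w → WColLe Adj' π' r (4 ^ c₂ * w)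
  wcol-bound {c₂ = c₂} col₂ = MaxCountLe-fibres WReach-map (λ (k , ws , _ , (W , _) , _) → k , ws , W)
    WReach-refl Adj'-sym isolated? (m^n>0 4 c₂) (fibre col₂)

lemma17 : ∀ {n m : ℕ} (G : SimpleGraph n) (L : DBipGraph n m) (π : Fin n ⊎ Fin m → ℕ) →
    IsDirLaconDecomp G L π →
    ∃[ m' ] Σ (BipGraph n m') λ L' → Σ (Fin n ⊎ Fin m' → ℕ) λ π' →
      IsLaconDecomp G L' π' ×
      (∀ (r c₂ c w : ℕ) →
        ColLe (DBipAdj L) π 2 c₂ →
        (ColLe (DBipAdj L) π r c → ColLe (BipAdj L') π' r (4 ^ c₂ * c)) ×
        (WColLe (DBipAdj L) π r w → WColLe (BipAdj L') π' r (4 ^ c₂ * w)))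
lemma17 {m = m} G L π dl =
  m * 3 ^ m , L' , π' , isLacon , λ r c₂ c w col₂ → col-bound col₂ , wcol-bound col₂
  where open Construction G L π dl
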